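{- For all integers $k,\ell$ with $1\leq k\leq \ell$, the polynomial \[C_{k-1}(q)\,C_{\ell+1}(q)-q^{\ell-k+1}\,C_k(q)\,C_\ell(q)\] has nonnegative coefficients.
   Context: For an integer $n\geq 0$, a lattice permutation with $n$ 1s and $n$ 2s is a word $\pi=\pi_1\cdots\pi_{2n}$ containing exactly $n$ letters $1$ and $n$ letters $2$ such that every initial segment $\pi_1\cdots\pi_j$ contains no more 2s than 1s. The inversion number ${\rm inv}\,\pi$ is the number of pairs $i<j$ with $\pi_i=2$ and $\pi_j=1$. The $q$-Catalan number is $C_n(q)=\sum_\pi q^{{\rm inv}\,\pi}$, the sum over all lattice permutations $\pi$ with $n$ 1s and $n$ 2s (so $C_0(q)=1$). Equivalently, $C_0(q)=1$ and $C_{n+1}(q)=\sum_{k=0}^n q^{(k+1)(n-k)}C_k(q)C_{n-k}(q)$. -}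

module Defs where

open import Data.Nat using (ℕ; zero; suc; _*_; _∸_)
open import Data.Integer using (ℤ; 0ℤ; 1ℤ; -_) renaming (_+_ to _+ℤ_; _*_ to _*ℤ_)
open import Data.List using (List; []; _∷_; map; foldr)
open import Data.Vec using (Vec; lookup; _∷ʳ_; last; allFin) renaming ([] to []ᵥ; _∷_ to _∷ᵥ_)
import Data.Vec as V
open import Data.Fin using (Fin; toℕ; opposite)

-- Polynomials in q with integer coefficients, as coefficient lists
-- (constant term first). Trailing zeros are allowed.
Poly : Set
Poly = List ℤ

coeff : Poly → ℕ → ℤ
coeff []       _       = 0ℤ
coeff (a ∷ p)  zero    = a
coeff (a ∷ p)  (suc i) = coeff p i

infixl 6 _⊕_ _⊖_
infixl 7 _⊗_

_⊕_ : Poly → Poly → Poly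
[]      ⊕ q       = q
(a ∷ p) ⊕ []      = a ∷ p
(a ∷ p) ⊕ (b ∷ q) = (a +ℤ b) ∷ (p ⊕ q)

negP : Poly → Poly
negP = map -_

_⊖_ : Poly → Poly → Poly
p ⊖ q = p ⊕ negP q

_⊗_ : Poly → Poly → Poly
[]      ⊗ q = []
(a ∷ p) ⊗ q = map (a *ℤ_) q ⊕ (0ℤ ∷ (p ⊗ q))

qpow* : ℕ → Poly → Poly
qpow* zero    p = p
qpow* (suc m) p = 0ℤ ∷ qpow* m p

onePoly : Poly
onePoly = 1ℤ ∷ []

sumP : List Poly → Poly
sumP = foldr _⊕_ []

-- Given [C_0, …, C_n], compute C_{n+1} = Σ_{k=0}^n q^{(k+1)(n-k)} C_k C_{n-k}
nextC : (n : ℕ) → Vec Poly (suc n) → Poly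
nextC n t = sumP (V.toList (V.map term (allFin (suc n))))
  where
  term : Fin (suc n) → Poly
  term k = qpow* (suc (toℕ k) * (n ∸ toℕ k)) (lookup t k ⊗ lookup t (opposite k))

table : (n : ℕ) → Vec Poly (suc n)
table zero    = onePoly ∷ᵥ []ᵥ
table (suc n) = table n ∷ʳ nextC n (table n)

qCatalan : ℕ → Poly
qCatalan n = last (table n)

NonnegCoeffs : Poly → Set
NonnegCoeffs p = ∀ i → 0ℤ Data.Integer.≤ coeff p i

-- Read lattice words as lattice paths (1 = up, 2 = down). Weighting the completions of a prefix
-- by the inversions they create gives the polynomials suffixes d h u below, and C_n is
-- suffixes 0 0 n: cutting a path where it first returns to the axis reproduces the recursion
-- of C_n.
--
-- Put c = ℓ - k + 1 and split C_k by its second letter. Each part is compared with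
-- C_(k-1) C_(ℓ+1) by running two partial paths α and β side by side. While α is strictly higher
-- than β, every combination of next steps preserves the invariants. When the heights meet,
-- exchanging the two tails moves c letters 1 from β to α. Because α has one more letter 2
-- than β, this multiplies the weight by exactly q^c.

module Submission where

open import Defs
open import Data.Nat using (ℕ; zero; suc; _+_; _*_; _∸_; _≤_; _<_; _≟_; z≤n; s≤s)
import Data.Nat.Properties as ℕₚ
open import Data.Nat.Induction using (<-rec)
open import Data.Nat.Tactic.RingSolver using (solve)
open import Data.Integer using (ℤ; 0ℤ; 1ℤ; +_; -_; +≤+) renaming (_+_ to _+ℤ_; _*_ to _*ℤ_; _≤_ to _≤ℤ_)
import Data.Integer.Properties as ℤₚ
open import Data.List using ([]; _∷_; map)
open import Data.Vec using (Vec; lookup; _∷ʳ_; tabulate; toList) renaming ([] to []ᵥ; _∷_ to _∷ᵥ_)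
import Data.Vec.Properties as Vecₚ
open import Data.Fin using (Fin; toℕ; opposite) renaming (zero to fzero; suc to fsuc)
import Data.Fin.Properties as Finₚ
open import Data.Empty using (⊥-elim)
open import Function using (_∘_; id)
open import Relation.Nullary using (yes; no)
open import Relation.Binary.PropositionalEquality
open import Relation.Binary.Structures using (IsEquivalence)
open import Relation.Binary.Bundles using (Setoid)
open import Algebra.Bundles using (CommutativeSemigroup)
import Algebra.Properties.CommutativeSemigroup as CommutativeSemigroupProperties
import Relation.Binary.Reasoning.Setoid as SetoidReasoning

infix 4 _≈_ _≼_
infixr 8 _·_

-- Polynomials up to trailing zeros

record _≈_ (p r : Poly) : Set where
  constructor mk≈
  field coeff-≡ : ∀ i → coeff p i ≡ coeff r i
open _≈_

≈-refl : ∀ {p} → p ≈ p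
≈-refl = mk≈ λ _ → refl

≈-sym : ∀ {p r} → p ≈ r → r ≈ p
≈-sym p≈r = mk≈ λ i → sym (coeff-≡ p≈r i)

≈-trans : ∀ {p r s} → p ≈ r → r ≈ s → p ≈ s
≈-trans p≈r r≈s = mk≈ λ i → trans (coeff-≡ p≈r i) (coeff-≡ r≈s i)

≈-reflexive : ∀ {p r} → p ≡ r → p ≈ r
≈-reflexive refl = ≈-refl

≈-isEquivalence : IsEquivalence _≈_
≈-isEquivalence = record { refl = ≈-refl ; sym = ≈-sym ; trans = ≈-trans }

≈-setoid : Setoid _ _
≈-setoid = record { isEquivalence = ≈-isEquivalence }

∷-cong : ∀ {a b p r} → a ≡ b → p ≈ r → a ∷ p ≈ b ∷ r
∷-cong a≡b p≈r = mk≈ λ { zero → a≡b ; (suc i) → coeff-≡ p≈r i }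

0∷[]≈[] : 0ℤ ∷ [] ≈ []
0∷[]≈[] = mk≈ λ { zero → refl ; (suc i) → refl }

coeff-⊕ : ∀ p r i → coeff (p ⊕ r) i ≡ coeff p i +ℤ coeff r i
coeff-⊕ []      r       i       = sym (ℤₚ.+-identityˡ _)
coeff-⊕ (a ∷ p) []      i       = sym (ℤₚ.+-identityʳ _)
coeff-⊕ (a ∷ p) (b ∷ r) zero    = refl
coeff-⊕ (a ∷ p) (b ∷ r) (suc i) = coeff-⊕ p r i

coeff-negP : ∀ p i → coeff (negP p) i ≡ - coeff p i
coeff-negP []      i       = refl
coeff-negP (a ∷ p) zero    = refl
coeff-negP (a ∷ p) (suc i) = coeff-negP p i

⊕-cong : ∀ {p p′ r r′} → p ≈ p′ → r ≈ r′ → p ⊕ r ≈ p′ ⊕ r′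
⊕-cong {p} {p′} {r} {r′} p≈p′ r≈r′ = mk≈ λ i →
  trans (coeff-⊕ p r i) (trans (cong₂ _+ℤ_ (coeff-≡ p≈p′ i) (coeff-≡ r≈r′ i)) (sym (coeff-⊕ p′ r′ i)))

⊕-comm : ∀ p r → p ⊕ r ≈ r ⊕ p
⊕-comm p r = mk≈ λ i →
  trans (coeff-⊕ p r i) (trans (ℤₚ.+-comm (coeff p i) _) (sym (coeff-⊕ r p i)))

⊕-assoc : ∀ p r s → (p ⊕ r) ⊕ s ≈ p ⊕ (r ⊕ s)
⊕-assoc p r s = mk≈ λ i → begin
  coeff ((p ⊕ r) ⊕ s) i
    ≡⟨ trans (coeff-⊕ (p ⊕ r) s i) (cong (_+ℤ coeff s i) (coeff-⊕ p r i)) ⟩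
  coeff p i +ℤ coeff r i +ℤ coeff s i
    ≡⟨ ℤₚ.+-assoc (coeff p i) _ _ ⟩
  coeff p i +ℤ (coeff r i +ℤ coeff s i)
    ≡⟨ sym (trans (coeff-⊕ p (r ⊕ s) i) (cong (coeff p i +ℤ_) (coeff-⊕ r s i))) ⟩
  coeff (p ⊕ (r ⊕ s)) i ∎
  where open ≡-Reasoning

⊕-identityʳ : ∀ p → p ⊕ [] ≈ p
⊕-identityʳ p = mk≈ λ i → trans (coeff-⊕ p [] i) (ℤₚ.+-identityʳ _)

⊕-commutativeSemigroup : CommutativeSemigroup _ _
⊕-commutativeSemigroup = record
  { _≈_ = _≈_
  ; _∙_ = _⊕_
  ; isCommutativeSemigroup = record
    { isSemigroup = record
      { isMagma = record { isEquivalence = ≈-isEquivalence ; ∙-cong = ⊕-cong }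
      ; assoc = ⊕-assoc
      }
    ; comm = ⊕-comm
    }
  }

open CommutativeSemigroupProperties ⊕-commutativeSemigroup
  using () renaming (interchange to ⊕-interchange)

_·_ : ℤ → Poly → Poly
a · p = map (a *ℤ_) p

coeff-· : ∀ a p i → coeff (a · p) i ≡ a *ℤ coeff p i
coeff-· a []      i       = sym (ℤₚ.*-zeroʳ a)
coeff-· a (b ∷ p) zero    = refl
coeff-· a (b ∷ p) (suc i) = coeff-· a p i

·-congʳ : ∀ a {p r} → p ≈ r → a · p ≈ a · r
·-congʳ a {p} {r} p≈r = mk≈ λ i →
  trans (coeff-· a p i) (trans (cong (a *ℤ_) (coeff-≡ p≈r i)) (sym (coeff-· a r i)))

·-distribˡ-⊕ : ∀ a p r → a · (p ⊕ r) ≈ a · p ⊕ a · r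
·-distribˡ-⊕ a p r = mk≈ λ i → begin
  coeff (a · (p ⊕ r)) i
    ≡⟨ trans (coeff-· a (p ⊕ r) i) (cong (a *ℤ_) (coeff-⊕ p r i)) ⟩
  a *ℤ (coeff p i +ℤ coeff r i)
    ≡⟨ ℤₚ.*-distribˡ-+ a (coeff p i) _ ⟩
  a *ℤ coeff p i +ℤ a *ℤ coeff r i
    ≡⟨ sym (trans (coeff-⊕ (a · p) (a · r) i) (cong₂ _+ℤ_ (coeff-· a p i) (coeff-· a r i))) ⟩
  coeff (a · p ⊕ a · r) i ∎
  where open ≡-Reasoning

·-distribʳ-+ : ∀ a b p → (a +ℤ b) · p ≈ a · p ⊕ b · p
·-distribʳ-+ a b p = mk≈ λ i → begin
  coeff ((a +ℤ b) · p) i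
    ≡⟨ coeff-· (a +ℤ b) p i ⟩
  (a +ℤ b) *ℤ coeff p i
    ≡⟨ ℤₚ.*-distribʳ-+ (coeff p i) a b ⟩
  a *ℤ coeff p i +ℤ b *ℤ coeff p i
    ≡⟨ sym (trans (coeff-⊕ (a · p) (b · p) i) (cong₂ _+ℤ_ (coeff-· a p i) (coeff-· b p i))) ⟩
  coeff (a · p ⊕ b · p) i ∎
  where open ≡-Reasoning

·-assoc : ∀ a b p → (a *ℤ b) · p ≈ a · b · p
·-assoc a b p = mk≈ λ i →
  trans (coeff-· (a *ℤ b) p i) (trans (ℤₚ.*-assoc a b (coeff p i))
    (sym (trans (coeff-· a (b · p) i) (cong (a *ℤ_) (coeff-· b p i)))))

·-zeroˡ : ∀ p → 0ℤ · p ≈ []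
·-zeroˡ p = mk≈ λ i → trans (coeff-· 0ℤ p i) (ℤₚ.*-zeroˡ (coeff p i))

·-identityˡ : ∀ p → 1ℤ · p ≈ p
·-identityˡ p = mk≈ λ i → trans (coeff-· 1ℤ p i) (ℤₚ.*-identityˡ (coeff p i))

open SetoidReasoning ≈-setoid

⊗-zeroʳ : ∀ p → p ⊗ [] ≈ []
⊗-zeroʳ []      = ≈-refl
⊗-zeroʳ (a ∷ p) = ≈-trans (∷-cong refl (⊗-zeroʳ p)) 0∷[]≈[]

⊗-identityˡ : ∀ p → onePoly ⊗ p ≈ p
⊗-identityˡ p = ≈-trans (⊕-cong (·-identityˡ p) 0∷[]≈[]) (⊕-identityʳ p)

0∷-⊗ : ∀ p r → (0ℤ ∷ p) ⊗ r ≈ 0ℤ ∷ (p ⊗ r)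
0∷-⊗ p r = ⊕-cong (·-zeroˡ r) ≈-refl

⊗-congʳ : ∀ p {r r′} → r ≈ r′ → p ⊗ r ≈ p ⊗ r′
⊗-congʳ []      r≈r′ = ≈-refl
⊗-congʳ (a ∷ p) r≈r′ = ⊕-cong (·-congʳ a r≈r′) (∷-cong refl (⊗-congʳ p r≈r′))

⊗-∷ʳ : ∀ p a r → p ⊗ (a ∷ r) ≈ a · p ⊕ (0ℤ ∷ (p ⊗ r))
⊗-∷ʳ []      a r = ≈-sym 0∷[]≈[]
⊗-∷ʳ (b ∷ p) a r = begin
  (b *ℤ a ∷ b · r) ⊕ (0ℤ ∷ (p ⊗ (a ∷ r)))
    ≈⟨ ⊕-cong (≈-refl {b *ℤ a ∷ b · r}) (∷-cong refl (⊗-∷ʳ p a r)) ⟩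
  (b *ℤ a ∷ b · r) ⊕ (0ℤ ∷ (a · p ⊕ (0ℤ ∷ (p ⊗ r))))
    ≈⟨ ∷-cong (cong (_+ℤ 0ℤ) (ℤₚ.*-comm b a)) (swap (b · r) (a · p) (0ℤ ∷ (p ⊗ r))) ⟩
  (a *ℤ b ∷ a · p) ⊕ (0ℤ ∷ (b · r ⊕ (0ℤ ∷ (p ⊗ r)))) ∎
  where
  swap : ∀ x y z → x ⊕ (y ⊕ z) ≈ y ⊕ (x ⊕ z)
  swap x y z =
    ≈-trans (≈-sym (⊕-assoc x y z)) (≈-trans (⊕-cong (⊕-comm x y) ≈-refl) (⊕-assoc y x z))

⊗-comm : ∀ p r → p ⊗ r ≈ r ⊗ p
⊗-comm []      r = ≈-sym (⊗-zeroʳ r)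
⊗-comm (a ∷ p) r = ≈-trans (⊕-cong (≈-refl {a · r}) (∷-cong refl (⊗-comm p r))) (≈-sym (⊗-∷ʳ r a p))

⊗-congˡ : ∀ {p p′} r → p ≈ p′ → p ⊗ r ≈ p′ ⊗ r
⊗-congˡ {p} {p′} r p≈p′ = ≈-trans (⊗-comm p r) (≈-trans (⊗-congʳ r p≈p′) (⊗-comm r p′))

⊗-cong : ∀ {p p′ r r′} → p ≈ p′ → r ≈ r′ → p ⊗ r ≈ p′ ⊗ r′
⊗-cong {p′ = p′} {r = r} p≈p′ r≈r′ = ≈-trans (⊗-congˡ r p≈p′) (⊗-congʳ p′ r≈r′)

⊗-distribʳ-⊕ : ∀ p r s → (p ⊕ r) ⊗ s ≈ p ⊗ s ⊕ r ⊗ s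
⊗-distribʳ-⊕ []      r       s = ≈-refl
⊗-distribʳ-⊕ (a ∷ p) []      s = ≈-sym (⊕-identityʳ _)
⊗-distribʳ-⊕ (a ∷ p) (b ∷ r) s = begin
  (a +ℤ b) · s ⊕ (0ℤ ∷ ((p ⊕ r) ⊗ s))
    ≈⟨ ⊕-cong (·-distribʳ-+ a b s) (∷-cong refl (⊗-distribʳ-⊕ p r s)) ⟩
  (a · s ⊕ b · s) ⊕ ((0ℤ ∷ (p ⊗ s)) ⊕ (0ℤ ∷ (r ⊗ s)))
    ≈⟨ ⊕-interchange (a · s) (b · s) _ _ ⟩
  (a · s ⊕ (0ℤ ∷ (p ⊗ s))) ⊕ (b · s ⊕ (0ℤ ∷ (r ⊗ s))) ∎

⊗-distribˡ-⊕ : ∀ p r s → p ⊗ (r ⊕ s) ≈ p ⊗ r ⊕ p ⊗ s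
⊗-distribˡ-⊕ p r s = begin
  p ⊗ (r ⊕ s)     ≈⟨ ⊗-comm p (r ⊕ s) ⟩
  (r ⊕ s) ⊗ p     ≈⟨ ⊗-distribʳ-⊕ r s p ⟩
  r ⊗ p ⊕ s ⊗ p   ≈⟨ ⊕-cong (⊗-comm r p) (⊗-comm s p) ⟩
  p ⊗ r ⊕ p ⊗ s   ∎

·-⊗ : ∀ a p r → a · p ⊗ r ≈ a · (p ⊗ r)
·-⊗ a []      r = ≈-refl
·-⊗ a (b ∷ p) r = begin
  (a *ℤ b) · r ⊕ (0ℤ ∷ (a · p ⊗ r))
    ≈⟨ ⊕-cong (·-assoc a b r) (∷-cong (sym (ℤₚ.*-zeroʳ a)) (·-⊗ a p r)) ⟩
  a · b · r ⊕ a · (0ℤ ∷ (p ⊗ r))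
    ≈⟨ ≈-sym (·-distribˡ-⊕ a (b · r) _) ⟩
  a · (b · r ⊕ (0ℤ ∷ (p ⊗ r))) ∎

⊗-assoc : ∀ p r s → (p ⊗ r) ⊗ s ≈ p ⊗ (r ⊗ s)
⊗-assoc []      r s = ≈-refl
⊗-assoc (a ∷ p) r s = begin
  (a · r ⊕ (0ℤ ∷ (p ⊗ r))) ⊗ s
    ≈⟨ ⊗-distribʳ-⊕ (a · r) _ s ⟩
  a · r ⊗ s ⊕ (0ℤ ∷ (p ⊗ r)) ⊗ s
    ≈⟨ ⊕-cong (·-⊗ a r s) (≈-trans (0∷-⊗ (p ⊗ r) s) (∷-cong refl (⊗-assoc p r s))) ⟩
  a · (r ⊗ s) ⊕ (0ℤ ∷ (p ⊗ (r ⊗ s))) ∎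

qpow*-cong : ∀ m {p r} → p ≈ r → qpow* m p ≈ qpow* m r
qpow*-cong zero    p≈r = p≈r
qpow*-cong (suc m) p≈r = ∷-cong refl (qpow*-cong m p≈r)

qpow*-[] : ∀ m → qpow* m [] ≈ []
qpow*-[] zero    = ≈-refl
qpow*-[] (suc m) = ≈-trans (∷-cong refl (qpow*-[] m)) 0∷[]≈[]

qpow*-⊕ : ∀ m p r → qpow* m (p ⊕ r) ≈ qpow* m p ⊕ qpow* m r
qpow*-⊕ zero    p r = ≈-refl
qpow*-⊕ (suc m) p r = ∷-cong refl (qpow*-⊕ m p r)

qpow*-+ : ∀ m n p → qpow* (m + n) p ≡ qpow* m (qpow* n p)
qpow*-+ zero    n p = refl
qpow*-+ (suc m) n p = cong (0ℤ ∷_) (qpow*-+ m n p)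

qpow*-comm : ∀ m n p → qpow* m (qpow* n p) ≡ qpow* n (qpow* m p)
qpow*-comm m n p =
  trans (sym (qpow*-+ m n p)) (trans (cong (λ k → qpow* k p) (ℕₚ.+-comm m n)) (qpow*-+ n m p))

qpow*-suc-comm : ∀ m n p → qpow* (suc m) (qpow* n p) ≡ qpow* (suc n) (qpow* m p)
qpow*-suc-comm m n p = cong (0ℤ ∷_) (qpow*-comm m n p)

qpow*-⊗ˡ : ∀ m p r → qpow* m p ⊗ r ≈ qpow* m (p ⊗ r)
qpow*-⊗ˡ zero    p r = ≈-refl
qpow*-⊗ˡ (suc m) p r = ≈-trans (0∷-⊗ (qpow* m p) r) (∷-cong refl (qpow*-⊗ˡ m p r))

qpow*-⊗ʳ : ∀ m p r → p ⊗ qpow* m r ≈ qpow* m (p ⊗ r)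
qpow*-⊗ʳ m p r = ≈-trans (⊗-comm p _) (≈-trans (qpow*-⊗ˡ m r p) (qpow*-cong m (⊗-comm r p)))

antidiagonalSum : ℕ → (ℕ → ℕ → Poly) → Poly
antidiagonalSum zero    g = g 0 0
antidiagonalSum (suc n) g = g 0 (suc n) ⊕ antidiagonalSum n (λ i j → g (suc i) j)

antidiagonalSum-cong : ∀ n {g g′} → (∀ i j → i + j ≡ n → g i j ≈ g′ i j) →
  antidiagonalSum n g ≈ antidiagonalSum n g′
antidiagonalSum-cong zero    g≈g′ = g≈g′ 0 0 refl
antidiagonalSum-cong (suc n) g≈g′ =
  ⊕-cong (g≈g′ 0 (suc n) refl) (antidiagonalSum-cong n λ i j i+j≡n → g≈g′ (suc i) j (cong suc i+j≡n))

antidiagonalSum-⊕ : ∀ n g h →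
  antidiagonalSum n (λ i j → g i j ⊕ h i j) ≈ antidiagonalSum n g ⊕ antidiagonalSum n h
antidiagonalSum-⊕ zero    g h = ≈-refl
antidiagonalSum-⊕ (suc n) g h =
  ≈-trans (⊕-cong (≈-refl {g 0 (suc n) ⊕ h 0 (suc n)})
                  (antidiagonalSum-⊕ n (λ i j → g (suc i) j) (λ i j → h (suc i) j)))
          (⊕-interchange (g 0 (suc n)) (h 0 (suc n)) _ _)

⊗-antidiagonalSum : ∀ n p g → p ⊗ antidiagonalSum n g ≈ antidiagonalSum n (λ i j → p ⊗ g i j)
⊗-antidiagonalSum zero    p g = ≈-refl
⊗-antidiagonalSum (suc n) p g =
  ≈-trans (⊗-distribˡ-⊕ p (g 0 (suc n)) _)
          (⊕-cong (≈-refl {p ⊗ g 0 (suc n)}) (⊗-antidiagonalSum n p (λ i j → g (suc i) j)))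

antidiagonalSum-⊗ : ∀ n g p → antidiagonalSum n g ⊗ p ≈ antidiagonalSum n (λ i j → g i j ⊗ p)
antidiagonalSum-⊗ zero    g p = ≈-refl
antidiagonalSum-⊗ (suc n) g p =
  ≈-trans (⊗-distribʳ-⊕ (g 0 (suc n)) _ p)
          (⊕-cong (≈-refl {g 0 (suc n) ⊗ p}) (antidiagonalSum-⊗ n (λ i j → g (suc i) j) p))

qpow*-antidiagonalSum : ∀ m n g →
  qpow* m (antidiagonalSum n g) ≈ antidiagonalSum n (λ i j → qpow* m (g i j))
qpow*-antidiagonalSum m zero    g = ≈-refl
qpow*-antidiagonalSum m (suc n) g =
  ≈-trans (qpow*-⊕ m (g 0 (suc n)) _)
          (⊕-cong (≈-refl {qpow* m (g 0 (suc n))}) (qpow*-antidiagonalSum m n (λ i j → g (suc i) j)))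

antidiagonalSum-assoc : ∀ n (f : ℕ → ℕ → ℕ → Poly) →
  antidiagonalSum n (λ i t → antidiagonalSum t (λ j k → f i j k))
    ≈ antidiagonalSum n (λ s k → antidiagonalSum s (λ i j → f i j k))
antidiagonalSum-assoc zero    f = ≈-refl
antidiagonalSum-assoc (suc n) f = begin
  antidiagonalSum (suc n) (f 0) ⊕ antidiagonalSum n (λ i t → antidiagonalSum t (f (suc i)))
    ≈⟨ ⊕-cong (≈-refl {antidiagonalSum (suc n) (f 0)}) (antidiagonalSum-assoc n (f ∘ suc)) ⟩
  (f 0 0 (suc n) ⊕ F₀) ⊕ F₁
    ≈⟨ ⊕-assoc (f 0 0 (suc n)) F₀ F₁ ⟩
  f 0 0 (suc n) ⊕ (F₀ ⊕ F₁)
    ≈⟨ ⊕-cong (≈-refl {f 0 0 (suc n)}) (≈-sym (antidiagonalSum-⊕ n _ _)) ⟩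
  f 0 0 (suc n) ⊕ antidiagonalSum n (λ s k → f 0 (suc s) k ⊕ antidiagonalSum s (λ i j → f (suc i) j k)) ∎
  where
  F₀ = antidiagonalSum n (λ j k → f 0 (suc j) k)
  F₁ = antidiagonalSum n (λ s k → antidiagonalSum s (λ i j → f (suc i) j k))

sumP-tabulate : ∀ n {f : Fin (suc n) → Poly} g → (∀ k → f k ≈ g (toℕ k) (n ∸ toℕ k)) →
  sumP (toList (tabulate f)) ≈ antidiagonalSum n g
sumP-tabulate zero    g f≈g = ≈-trans (⊕-identityʳ _) (f≈g fzero)
sumP-tabulate (suc n) g f≈g =
  ⊕-cong (f≈g fzero) (sumP-tabulate n (λ i j → g (suc i) j) (f≈g ∘ fsuc))

lookup-∷ʳ⁺ : ∀ {A : Set} {P : ℕ → A → Set} {n} (xs : Vec A n) {x} →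
  (∀ k → P (toℕ k) (lookup xs k)) → P n x → ∀ k → P (toℕ k) (lookup (xs ∷ʳ x) k)
lookup-∷ʳ⁺         []ᵥ       _   Px fzero    = Px
lookup-∷ʳ⁺         (y ∷ᵥ ys) Pxs Px fzero    = Pxs fzero
lookup-∷ʳ⁺ {P = P} (y ∷ᵥ ys) Pxs Px (fsuc k) = lookup-∷ʳ⁺ {P = P ∘ suc} ys (Pxs ∘ fsuc) Px k

record _≼_ (p r : Poly) : Set where
  constructor mk≼
  field coeff-≤ : ∀ i → coeff p i ≤ℤ coeff r i
open _≼_

≼-reflexive : ∀ {p r} → p ≈ r → p ≼ r
≼-reflexive p≈r = mk≼ λ i → ℤₚ.≤-reflexive (coeff-≡ p≈r i)

≼-trans : ∀ {p r s} → p ≼ r → r ≼ s → p ≼ s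
≼-trans p≼r r≼s = mk≼ λ i → ℤₚ.≤-trans (coeff-≤ p≼r i) (coeff-≤ r≼s i)

≼-resp-≈ : ∀ {p p′ r r′} → p ≈ p′ → r ≈ r′ → p ≼ r → p′ ≼ r′
≼-resp-≈ p≈p′ r≈r′ p≼r = ≼-trans (≼-reflexive (≈-sym p≈p′)) (≼-trans p≼r (≼-reflexive r≈r′))

⊕-mono-≼ : ∀ {p p′ r r′} → p ≼ p′ → r ≼ r′ → p ⊕ r ≼ p′ ⊕ r′
⊕-mono-≼ {p} {p′} {r} {r′} p≼p′ r≼r′ = mk≼ λ i →
  subst₂ _≤ℤ_ (sym (coeff-⊕ p r i)) (sym (coeff-⊕ p′ r′ i))
               (ℤₚ.+-mono-≤ (coeff-≤ p≼p′ i) (coeff-≤ r≼r′ i))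

qpow*-mono-≼ : ∀ m {p r} → p ≼ r → qpow* m p ≼ qpow* m r
qpow*-mono-≼ zero    p≼r = p≼r
qpow*-mono-≼ (suc m) p≼r = mk≼ λ where
  zero    → ℤₚ.≤-refl
  (suc i) → coeff-≤ (qpow*-mono-≼ m p≼r) i

nonneg⇒[]≼ : ∀ {p} → NonnegCoeffs p → [] ≼ p
nonneg⇒[]≼ p≥0 = mk≼ p≥0

≼⇒nonneg-⊖ : ∀ {p r} → p ≼ r → NonnegCoeffs (r ⊖ p)
≼⇒nonneg-⊖ {p} {r} p≼r i =
  subst (0ℤ ≤ℤ_) (sym (trans (coeff-⊕ r (negP p) i) (cong (coeff r i +ℤ_) (coeff-negP p i))))
        (ℤₚ.i≤j⇒0≤j-i (coeff-≤ p≼r i))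

nonneg-onePoly : NonnegCoeffs onePoly
nonneg-onePoly zero    = +≤+ z≤n
nonneg-onePoly (suc i) = ℤₚ.≤-refl

nonneg-⊕ : ∀ {p r} → NonnegCoeffs p → NonnegCoeffs r → NonnegCoeffs (p ⊕ r)
nonneg-⊕ {p} {r} p≥0 r≥0 i =
  subst (0ℤ ≤ℤ_) (sym (coeff-⊕ p r i)) (ℤₚ.+-mono-≤ (p≥0 i) (r≥0 i))

nonneg-qpow* : ∀ m {p} → NonnegCoeffs p → NonnegCoeffs (qpow* m p)
nonneg-qpow* zero    p≥0 = p≥0
nonneg-qpow* (suc m) p≥0 zero    = ℤₚ.≤-refl
nonneg-qpow* (suc m) p≥0 (suc i) = nonneg-qpow* m p≥0 i

nonneg-· : ∀ {a p} → 0ℤ ≤ℤ a → NonnegCoeffs p → NonnegCoeffs (a · p)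
nonneg-· {a} {p} a≥0 p≥0 i = subst (0ℤ ≤ℤ_) (sym (coeff-· a p i)) (0≤* a≥0 (p≥0 i))
  where
  0≤* : ∀ {x y} → 0ℤ ≤ℤ x → 0ℤ ≤ℤ y → 0ℤ ≤ℤ x *ℤ y
  0≤* {+ m} {+ n} _ _ = subst (0ℤ ≤ℤ_) (ℤₚ.pos-* m n) (+≤+ z≤n)

nonneg-⊗ : ∀ p {r} → NonnegCoeffs p → NonnegCoeffs r → NonnegCoeffs (p ⊗ r)
nonneg-⊗ []      p≥0 r≥0 = p≥0
nonneg-⊗ (a ∷ p) {r} p≥0 r≥0 =
  nonneg-⊕ {a · r} (nonneg-· {p = r} (p≥0 zero) r≥0) (nonneg-qpow* 1 (nonneg-⊗ p (p≥0 ∘ suc) r≥0))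

-- Lattice paths

-- suffixes d h u weights the completions of a prefix that has d letters 2 and h more 1s than 2s
-- by u further 1s (and h + u further 2s), with q^(inversions involving a letter of the
-- completion); so a completing 1 placed after d′ letters 2 contributes q^d′. suffixes↑ and
-- suffixes↓ collect the completions that begin with 1 and with 2, respectively.
suffixes : ℕ → ℕ → ℕ → Poly
suffixes d zero    zero    = onePoly
suffixes d zero    (suc u) = qpow* d (suffixes d 1 u)
suffixes d (suc h) zero    = suffixes (suc d) h zero
suffixes d (suc h) (suc u) = qpow* d (suffixes d (suc (suc h)) u) ⊕ suffixes (suc d) h (suc u)

suffixes↑ : ℕ → ℕ → ℕ → Poly
suffixes↑ d h zero    = []
suffixes↑ d h (suc u) = qpow* d (suffixes d (suc h) u)

suffixes↓ : ℕ → ℕ → ℕ → Poly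
suffixes↓ d zero    u = []
suffixes↓ d (suc h) u = suffixes (suc d) h u

suffixes-split-height : ∀ d h u →
  suffixes d (suc h) u ≈ suffixes↑ d (suc h) u ⊕ suffixes↓ d (suc h) u
suffixes-split-height d h zero    = ≈-refl
suffixes-split-height d h (suc u) = ≈-refl

suffixes-split-ups : ∀ d h u →
  suffixes d h (suc u) ≈ suffixes↑ d h (suc u) ⊕ suffixes↓ d h (suc u)
suffixes-split-ups d zero    u = ≈-sym (⊕-identityʳ _)
suffixes-split-ups d (suc h) u = ≈-refl

nonneg-suffixes : ∀ d h u → NonnegCoeffs (suffixes d h u)
nonneg-suffixes d zero    zero    = nonneg-onePoly
nonneg-suffixes d zero    (suc u) = nonneg-qpow* d (nonneg-suffixes d 1 u)
nonneg-suffixes d (suc h) zero    = nonneg-suffixes (suc d) h zero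
nonneg-suffixes d (suc h) (suc u) =
  nonneg-⊕ {qpow* d (suffixes d (suc (suc h)) u)} (nonneg-qpow* d (nonneg-suffixes d (suc (suc h)) u))
                                                  (nonneg-suffixes (suc d) h (suc u))

nonneg-suffixes↑ : ∀ d h u → NonnegCoeffs (suffixes↑ d h u)
nonneg-suffixes↑ d h zero    = λ _ → ℤₚ.≤-refl
nonneg-suffixes↑ d h (suc u) = nonneg-qpow* d (nonneg-suffixes d (suc h) u)

nonneg-suffixes↓ : ∀ d h u → NonnegCoeffs (suffixes↓ d h u)
nonneg-suffixes↓ d zero    u = λ _ → ℤₚ.≤-refl
nonneg-suffixes↓ d (suc h) u = nonneg-suffixes (suc d) h u

suffixes-suc : ∀ d h u → suffixes (suc d) h u ≈ qpow* u (suffixes d h u)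
suffixes-suc d zero    zero    = ≈-refl
suffixes-suc d zero    (suc u) =
  ≈-trans (qpow*-cong (suc d) (suffixes-suc d 1 u)) (≈-reflexive (qpow*-suc-comm d u _))
suffixes-suc d (suc h) zero    = suffixes-suc (suc d) h zero
suffixes-suc d (suc h) (suc u) = begin
  qpow* (suc d) (suffixes (suc d) (suc (suc h)) u) ⊕ suffixes (suc (suc d)) h (suc u)
    ≈⟨ ⊕-cong (qpow*-cong (suc d) (suffixes-suc d (suc (suc h)) u)) (suffixes-suc (suc d) h (suc u)) ⟩
  qpow* (suc d) (qpow* u (suffixes d (suc (suc h)) u)) ⊕ qpow* (suc u) (suffixes (suc d) h (suc u))
    ≈⟨ ⊕-cong (≈-reflexive (qpow*-suc-comm d u _)) (≈-refl {qpow* (suc u) (suffixes (suc d) h (suc u))}) ⟩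
  qpow* (suc u) (qpow* d (suffixes d (suc (suc h)) u)) ⊕ qpow* (suc u) (suffixes (suc d) h (suc u))
    ≈⟨ ≈-sym (qpow*-⊕ (suc u) _ _) ⟩
  qpow* (suc u) (qpow* d (suffixes d (suc (suc h)) u) ⊕ suffixes (suc d) h (suc u)) ∎

suffixes-qpow* : ∀ d h u → suffixes d h u ≈ qpow* (d * u) (suffixes 0 h u)
suffixes-qpow* zero    h u = ≈-refl
suffixes-qpow* (suc d) h u = begin
  suffixes (suc d) h u                     ≈⟨ suffixes-suc d h u ⟩
  qpow* u (suffixes d h u)                 ≈⟨ qpow*-cong u (suffixes-qpow* d h u) ⟩
  qpow* u (qpow* (d * u) (suffixes 0 h u)) ≈⟨ ≈-reflexive (sym (qpow*-+ u (d * u) _)) ⟩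
  qpow* (suc d * u) (suffixes 0 h u)       ∎

firstPassage : ∀ u d h →
  suffixes d (suc h) u ≈ antidiagonalSum u (λ i t → suffixes d 0 i ⊗ suffixes (suc (d + i)) h t)
firstPassage = <-rec FirstPassage passage
  where
  FirstPassage : ℕ → Set
  FirstPassage u = ∀ d h →
    suffixes d (suc h) u ≈ antidiagonalSum u (λ i t → suffixes d 0 i ⊗ suffixes (suc (d + i)) h t)

  <suc-of-+≡ˡ : ∀ {i j n} → i + j ≡ n → i < suc n
  <suc-of-+≡ˡ refl = s≤s (ℕₚ.m≤m+n _ _)

  <suc-of-+≡ʳ : ∀ {i j n} → i + j ≡ n → j < suc n
  <suc-of-+≡ʳ refl = s≤s (ℕₚ.m≤n+m _ _)

  emptyExcursion : ∀ d h u → suffixes (suc d) h u ≈ suffixes d 0 0 ⊗ suffixes (suc (d + 0)) h u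
  emptyExcursion d h u =
    ≈-sym (≈-trans (⊗-identityˡ _) (≈-reflexive (cong (λ k → suffixes (suc k) h u) (ℕₚ.+-identityʳ d))))

  passage : ∀ u → (∀ {t} → t < u → FirstPassage t) → FirstPassage u
  passage zero    _  d h = emptyExcursion d h 0
  passage (suc u) IH d h = begin
    qpow* d (S d (suc (suc h)) u) ⊕ S (suc d) h (suc u)
      ≈⟨ ⊕-comm _ (S (suc d) h (suc u)) ⟩
    S (suc d) h (suc u) ⊕ qpow* d (S d (suc (suc h)) u)
      ≈⟨ ⊕-cong (emptyExcursion d h (suc u)) afterFirstUp ⟩
    antidiagonalSum (suc u) (λ i t → S d 0 i ⊗ S (suc (d + i)) h t) ∎
    where
    S = suffixes

    regroup : ∀ s b →
      antidiagonalSum s (λ i a → S d 0 i ⊗ (S (suc (d + i)) 0 a ⊗ S (suc (suc (d + i) + a)) h b))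
        ≈ antidiagonalSum s (λ i a → S d 0 i ⊗ S (suc (d + i)) 0 a) ⊗ S (suc (d + suc s)) h b
    regroup s b =
      ≈-trans (antidiagonalSum-cong s λ i a i+a≡s →
                 ≈-trans (≈-sym (⊗-assoc (S d 0 i) _ _))
                         (⊗-congʳ (S d 0 i ⊗ S (suc (d + i)) 0 a)
                                  (≈-reflexive (cong (λ k → S k h b) (index i a i+a≡s)))))
              (≈-sym (antidiagonalSum-⊗ s _ _))
      where
      index : ∀ i a → i + a ≡ s → suc (suc (d + i) + a) ≡ suc (d + suc s)
      index i a refl = solve (d ∷ i ∷ a ∷ [])

    afterFirstUp :
      qpow* d (S d (suc (suc h)) u) ≈ antidiagonalSum u (λ s b → S d 0 (suc s) ⊗ S (suc (d + suc s)) h b)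
    afterFirstUp = begin
      qpow* d (S d (suc (suc h)) u)
        ≈⟨ qpow*-cong d (IH (s≤s ℕₚ.≤-refl) d (suc h)) ⟩
      qpow* d (antidiagonalSum u (λ i t → S d 0 i ⊗ S (suc (d + i)) (suc h) t))
        ≈⟨ qpow*-cong d (antidiagonalSum-cong u λ i t i+t≡u →
             ≈-trans (⊗-congʳ (S d 0 i) (IH {t} (<suc-of-+≡ʳ i+t≡u) (suc (d + i)) h))
                     (⊗-antidiagonalSum t (S d 0 i) _)) ⟩
      qpow* d (antidiagonalSum u (λ i t → antidiagonalSum t (λ a b →
        S d 0 i ⊗ (S (suc (d + i)) 0 a ⊗ S (suc (suc (d + i) + a)) h b))))
        ≈⟨ qpow*-cong d (antidiagonalSum-assoc u _) ⟩
      qpow* d (antidiagonalSum u (λ s b → antidiagonalSum s (λ i a →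
        S d 0 i ⊗ (S (suc (d + i)) 0 a ⊗ S (suc (suc (d + i) + a)) h b))))
        ≈⟨ qpow*-cong d (antidiagonalSum-cong u λ s b s+b≡u →
             ≈-trans (regroup s b) (⊗-congˡ _ (≈-sym (IH {s} (<suc-of-+≡ˡ s+b≡u) d 0)))) ⟩
      qpow* d (antidiagonalSum u (λ s b → S d 1 s ⊗ S (suc (d + suc s)) h b))
        ≈⟨ qpow*-antidiagonalSum d u _ ⟩
      antidiagonalSum u (λ s b → qpow* d (S d 1 s ⊗ S (suc (d + suc s)) h b))
        ≈⟨ antidiagonalSum-cong u (λ s b _ → ≈-sym (qpow*-⊗ˡ d (S d 1 s) _)) ⟩
      antidiagonalSum u (λ s b → S d 0 (suc s) ⊗ S (suc (d + suc s)) h b) ∎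

catalan : ℕ → Poly
catalan = suffixes 0 0

catalan-suc : ∀ n →
  catalan (suc n) ≈ antidiagonalSum n (λ i j → qpow* (suc i * j) (catalan i ⊗ catalan j))
catalan-suc n = ≈-trans (firstPassage n 0 0) (antidiagonalSum-cong n λ i j _ →
  ≈-trans (⊗-congʳ (catalan i) (suffixes-qpow* (suc i) 0 j))
          (qpow*-⊗ʳ (suc i * j) (catalan i) (catalan j)))

nextC-≈ : ∀ n t (Q : ℕ → Poly) → (∀ k → lookup t k ≈ Q (toℕ k)) →
  nextC n t ≈ antidiagonalSum n (λ i j → qpow* (suc i * j) (Q i ⊗ Q j))
nextC-≈ n t Q t≈Q =
  ≈-trans (≈-reflexive (cong (sumP ∘ toList) (sym (Vecₚ.tabulate-∘ term id))))
          (sumP-tabulate n _ λ k → qpow*-cong _ (⊗-cong (t≈Q k) (opposite≈ k)))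
  where
  opposite≈ : ∀ k → lookup t (opposite k) ≈ Q (n ∸ toℕ k)
  opposite≈ k = ≈-trans (t≈Q (opposite k)) (≈-reflexive (cong Q (Finₚ.opposite-prop k)))

  term : Fin (suc n) → Poly
  term k = qpow* (suc (toℕ k) * (n ∸ toℕ k)) (lookup t k ⊗ lookup t (opposite k))

mutual
  table-≈ : ∀ n k → lookup (table n) k ≈ catalan (toℕ k)
  table-≈ zero    fzero = ≈-refl
  table-≈ (suc n)       = lookup-∷ʳ⁺ {P = λ i p → p ≈ catalan i} (table n) (table-≈ n) (nextC-table n)

  nextC-table : ∀ n → nextC n (table n) ≈ catalan (suc n)
  nextC-table n = ≈-trans (nextC-≈ n (table n) catalan (table-≈ n)) (≈-sym (catalan-suc n))

qCatalan≈catalan : ∀ n → qCatalan n ≈ catalan n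
qCatalan≈catalan zero    = ≈-refl
qCatalan≈catalan (suc n) =
  ≈-trans (≈-reflexive (Vecₚ.last-∷ʳ (nextC n (table n)) (table n))) (nextC-table n)

-- The exchange inequality

record Exchange (c : ℕ) (X Y X′ Y′ : Poly) : Set where
  constructor mkExchange
  field shifted-≼ : qpow* c (X ⊗ Y) ≼ X′ ⊗ Y′
open Exchange

exchange-⊕ˡ : ∀ {c X₁ X₂ Y X₁′ X₂′ Y′} →
  Exchange c X₁ Y X₁′ Y′ → Exchange c X₂ Y X₂′ Y′ → Exchange c (X₁ ⊕ X₂) Y (X₁′ ⊕ X₂′) Y′
exchange-⊕ˡ {c} {X₁} {X₂} {Y} {X₁′} {X₂′} {Y′} (mkExchange e₁) (mkExchange e₂) = mkExchange
  (≼-resp-≈ (≈-sym (≈-trans (qpow*-cong c (⊗-distribʳ-⊕ X₁ X₂ Y)) (qpow*-⊕ c _ _)))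
            (≈-sym (⊗-distribʳ-⊕ X₁′ X₂′ Y′))
            (⊕-mono-≼ e₁ e₂))

exchange-⊕ʳ : ∀ {c X Y₁ Y₂ X′ Y₁′ Y₂′} →
  Exchange c X Y₁ X′ Y₁′ → Exchange c X Y₂ X′ Y₂′ → Exchange c X (Y₁ ⊕ Y₂) X′ (Y₁′ ⊕ Y₂′)
exchange-⊕ʳ {c} {X} {Y₁} {Y₂} {X′} {Y₁′} {Y₂′} (mkExchange e₁) (mkExchange e₂) = mkExchange
  (≼-resp-≈ (≈-sym (≈-trans (qpow*-cong c (⊗-distribˡ-⊕ X Y₁ Y₂)) (qpow*-⊕ c _ _)))
            (≈-sym (⊗-distribˡ-⊕ X′ Y₁′ Y₂′))
            (⊕-mono-≼ e₁ e₂))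

exchange-qpow* : ∀ {c X Y X′ Y′} m n →
  Exchange c X Y X′ Y′ → Exchange c (qpow* m X) (qpow* n Y) (qpow* m X′) (qpow* n Y′)
exchange-qpow* {c} {X} {Y} {X′} {Y′} m n (mkExchange e) = mkExchange
  (≼-resp-≈ (≈-sym (≈-trans (qpow*-cong c (qpow*-⊗-qpow* X Y))
                            (≈-reflexive (trans (qpow*-comm c m _)
                                                (cong (qpow* m) (qpow*-comm c n (X ⊗ Y)))))))
            (≈-sym (qpow*-⊗-qpow* X′ Y′))
            (qpow*-mono-≼ m (qpow*-mono-≼ n e)))
  where
  qpow*-⊗-qpow* : ∀ P Q → qpow* m P ⊗ qpow* n Q ≈ qpow* m (qpow* n (P ⊗ Q))
  qpow*-⊗-qpow* P Q = ≈-trans (qpow*-⊗ˡ m P (qpow* n Q)) (qpow*-cong m (qpow*-⊗ʳ n P Q))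

exchange-[]ˡ : ∀ {c Y X′ Y′} → NonnegCoeffs X′ → NonnegCoeffs Y′ → Exchange c [] Y X′ Y′
exchange-[]ˡ {c} {X′ = X′} X′≥0 Y′≥0 =
  mkExchange (≼-resp-≈ (≈-sym (qpow*-[] c)) ≈-refl (nonneg⇒[]≼ (nonneg-⊗ X′ X′≥0 Y′≥0)))

exchange-[]ʳ : ∀ {c X X′ Y′} → NonnegCoeffs X′ → NonnegCoeffs Y′ → Exchange c X [] X′ Y′
exchange-[]ʳ {c} {X} {X′} X′≥0 Y′≥0 =
  mkExchange (≼-resp-≈ (≈-sym (≈-trans (qpow*-cong c (⊗-zeroʳ X)) (qpow*-[] c))) ≈-refl
                       (nonneg⇒[]≼ (nonneg-⊗ X′ X′≥0 Y′≥0)))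

exchange-resp-≈ : ∀ {c X Y X′ Y′ X₀ Y₀ X₀′ Y₀′} → X ≈ X₀ → Y ≈ Y₀ → X′ ≈ X₀′ → Y′ ≈ Y₀′ →
  Exchange c X₀ Y₀ X₀′ Y₀′ → Exchange c X Y X′ Y′
exchange-resp-≈ {c} X≈ Y≈ X′≈ Y′≈ (mkExchange e) =
  mkExchange (≼-resp-≈ (≈-sym (qpow*-cong c (⊗-cong X≈ Y≈))) (≈-sym (⊗-cong X′≈ Y′≈)) e)

exchange-swap : ∀ d h u c →
  Exchange c (suffixes (suc d) h u) (suffixes d h (u + c)) (suffixes (suc d) h (u + c)) (suffixes d h u)
exchange-swap d h u c = mkExchange (≼-reflexive (begin
  qpow* c (suffixes (suc d) h u ⊗ Y)
    ≈⟨ qpow*-cong c (≈-trans (⊗-congˡ Y (suffixes-suc d h u)) (qpow*-⊗ˡ u X Y)) ⟩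
  qpow* c (qpow* u (X ⊗ Y))
    ≈⟨ ≈-reflexive (trans (sym (qpow*-+ c u (X ⊗ Y))) (cong (λ k → qpow* k (X ⊗ Y)) (ℕₚ.+-comm c u))) ⟩
  qpow* (u + c) (X ⊗ Y)
    ≈⟨ qpow*-cong (u + c) (⊗-comm X Y) ⟩
  qpow* (u + c) (Y ⊗ X)
    ≈⟨ ≈-sym (≈-trans (⊗-congˡ X (suffixes-suc d h (u + c))) (qpow*-⊗ˡ (u + c) Y X)) ⟩
  suffixes (suc d) h (u + c) ⊗ X ∎))
  where
  X = suffixes d h u
  Y = suffixes d h (u + c)

+-2*suc : ∀ m n → m + 2 * suc n ≡ suc (suc (m + 2 * n))
+-2*suc m n = solve (m ∷ n ∷ [])

parity⇒< : ∀ {a b u v} → b ≤ a → suc a + 2 * u ≡ b + 2 * suc v → b < a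
parity⇒< {a} {b} {u} {v} b≤a len≡ = ℕₚ.≤∧≢⇒< b≤a λ { refl →
  ℕₚ.even≢odd u v (ℕₚ.+-cancelˡ-≡ a _ _
    (trans (ℕₚ.suc-injective (trans len≡ (+-2*suc a v))) (sym (ℕₚ.+-suc a (2 * v))))) }

exchange-sameHeight : ∀ dα dβ a u v c → a + 2 * u ≡ a + 2 * v → dα + v ≡ suc (dβ + u) →
  Exchange c (suffixes dα a u) (suffixes dβ a (v + c)) (suffixes dα a (u + c)) (suffixes dβ a v)
exchange-sameHeight dα dβ a u v c len≡ d≡
  with ℕₚ.*-cancelˡ-≡ u v 2 (ℕₚ.+-cancelˡ-≡ a _ _ len≡)
... | refl with ℕₚ.+-cancelʳ-≡ u dα (suc dβ) d≡
...   | refl = exchange-swap dβ a u c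

-- α = (dα, a, u) and β = (dβ, b, v) are partial paths in the coordinates of suffixes: α is not
-- below β, after u and v more 1s respectively they have equally many letters left, and
-- α has one more letter 2 in total.
mutual
  suffixes-exchange : ∀ dα dβ a b u v c → b ≤ a → a + 2 * u ≡ b + 2 * v → dα + v ≡ suc (dβ + u) →
    Exchange c (suffixes dα a u) (suffixes dβ b (v + c)) (suffixes dα a (u + c)) (suffixes dβ b v)
  suffixes-exchange dα dβ a b u v c b≤a len≡ d≡ with a ≟ b
  ... | yes refl = exchange-sameHeight dα dβ a u v c len≡ d≡
  ... | no a≢b   = exchange-higher dα dβ a b u v c (ℕₚ.≤∧≢⇒< b≤a (a≢b ∘ sym)) len≡ d≡

  exchange-higher : ∀ dα dβ a b u v c → b < a → a + 2 * u ≡ b + 2 * v → dα + v ≡ suc (dβ + u) →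
    Exchange c (suffixes dα a u) (suffixes dβ b (v + c)) (suffixes dα a (u + c)) (suffixes dβ b v)
  exchange-higher dα dβ (suc a) b u zero    c (s≤s b≤a) len≡ d≡ =
    -- α is strictly higher, so equal lengths force v > u
    ⊥-elim (ℕₚ.<-irrefl refl (ℕₚ.≤-trans (s≤s b≤a)
      (subst (suc a ≤_) (trans len≡ (ℕₚ.+-identityʳ b)) (ℕₚ.m≤m+n (suc a) (2 * u)))))
  exchange-higher dα dβ (suc a) b u (suc v) c (s≤s b≤a) len≡ d≡ =
    exchange-resp-≈ (suffixes-split-height dα a u) (suffixes-split-ups dβ b (v + c))
                    (suffixes-split-height dα a (u + c)) (suffixes-split-ups dβ b v)
                    (exchange-⊕ˡ (exchange-⊕ʳ (upUp u len≡ d≡) (upDown u b b≤a len≡ d≡))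
                                 (exchange-⊕ʳ downUp (downDown b b≤a len≡ d≡)))
    where
    upUp : ∀ u → suc a + 2 * u ≡ b + 2 * suc v → dα + suc v ≡ suc (dβ + u) →
      Exchange c (suffixes↑ dα (suc a) u)       (suffixes↑ dβ b (suc (v + c)))
                 (suffixes↑ dα (suc a) (u + c)) (suffixes↑ dβ b (suc v))
    upUp zero    _    _  =
      exchange-[]ˡ (nonneg-suffixes↑ dα (suc a) c) (nonneg-suffixes↑ dβ b (suc v))
    upUp (suc u) len≡ d≡ = exchange-qpow* dα dβ (suffixes-exchange dα dβ (suc (suc a)) (suc b) u v c
      (s≤s (ℕₚ.m≤n⇒m≤1+n b≤a))
      (ℕₚ.suc-injective (subst₂ _≡_ (+-2*suc (suc a) u) (+-2*suc b v) len≡))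
      (ℕₚ.suc-injective (subst₂ _≡_ (ℕₚ.+-suc dα v) (cong suc (ℕₚ.+-suc dβ u)) d≡)))

    upDown : ∀ u b → b ≤ a → suc a + 2 * u ≡ b + 2 * suc v → dα + suc v ≡ suc (dβ + u) →
      Exchange c (suffixes↑ dα (suc a) u)       (suffixes↓ dβ b (suc (v + c)))
                 (suffixes↑ dα (suc a) (u + c)) (suffixes↓ dβ b (suc v))
    upDown zero    b       _   _    _  =
      exchange-[]ˡ (nonneg-suffixes↑ dα (suc a) c) (nonneg-suffixes↓ dβ b (suc v))
    upDown (suc u) zero    _   _    _  =
      exchange-[]ʳ (nonneg-suffixes↑ dα (suc a) (suc u + c)) (nonneg-suffixes↓ dβ 0 (suc v))
    upDown (suc u) (suc b) b<a len≡ d≡ =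
      exchange-qpow* dα 0 (suffixes-exchange dα (suc dβ) (suc (suc a)) b u (suc v) c
      (ℕₚ.m≤n⇒m≤1+n (ℕₚ.m≤n⇒m≤1+n (ℕₚ.<⇒≤ b<a)))
      (ℕₚ.suc-injective (trans (sym (+-2*suc (suc a) u)) len≡))
      (trans d≡ (cong suc (ℕₚ.+-suc dβ u))))

    downUp : Exchange c (suffixes↓ dα (suc a) u)       (suffixes↑ dβ b (suc (v + c)))
                        (suffixes↓ dα (suc a) (u + c)) (suffixes↑ dβ b (suc v))
    downUp = exchange-qpow* 0 dβ (suffixes-exchange (suc dα) dβ a (suc b) u v c
      (parity⇒< {u = u} b≤a len≡)
      (ℕₚ.suc-injective (trans len≡ (+-2*suc b v)))
      (trans (sym (ℕₚ.+-suc dα v)) d≡))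

    downDown : ∀ b → b ≤ a → suc a + 2 * u ≡ b + 2 * suc v → dα + suc v ≡ suc (dβ + u) →
      Exchange c (suffixes↓ dα (suc a) u)       (suffixes↓ dβ b (suc (v + c)))
                 (suffixes↓ dα (suc a) (u + c)) (suffixes↓ dβ b (suc v))
    downDown zero    _   _    _  =
      exchange-[]ʳ (nonneg-suffixes (suc dα) a (u + c)) (nonneg-suffixes↓ dβ 0 (suc v))
    downDown (suc b) b<a len≡ d≡ =
      suffixes-exchange (suc dα) (suc dβ) a b u (suc v) c (ℕₚ.<⇒≤ b<a) (ℕₚ.suc-injective len≡) (cong suc d≡)

catalan-exchange : ∀ k c →
  qpow* c (catalan (suc k) ⊗ catalan (k + c)) ≼ catalan k ⊗ catalan (suc (k + c))
catalan-exchange k c =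
  ≼-resp-≈ ≈-refl (⊗-comm _ (catalan k))
    (shifted-≼ (exchange-resp-≈ (suffixes-split-height 0 0 k) ≈-refl
                                (suffixes-split-height 0 0 (k + c)) ≈-refl
                                (exchange-⊕ˡ (firstUp k) (exchange-swap 0 0 k c))))
  where
  firstUp : ∀ k → Exchange c (suffixes↑ 0 1 k) (catalan (k + c)) (suffixes↑ 0 1 (k + c)) (catalan k)
  firstUp zero    = exchange-[]ˡ (nonneg-suffixes↑ 0 1 c) (nonneg-suffixes 0 0 0)
  firstUp (suc u) = suffixes-exchange 0 0 2 0 u (suc u) c z≤n (sym (+-2*suc 0 u)) refl

qCatalan-exchange : ∀ k c →
  qpow* c (qCatalan (suc k) ⊗ qCatalan (k + c)) ≼ qCatalan k ⊗ qCatalan (suc (k + c))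
qCatalan-exchange k c =
  ≼-resp-≈ (qpow*-cong c (≈-sym (⊗-cong (qCatalan≈catalan (suc k)) (qCatalan≈catalan (k + c)))))
           (≈-sym (⊗-cong (qCatalan≈catalan k) (qCatalan≈catalan (suc (k + c)))))
           (catalan-exchange k c)

mainTheorem1 : ∀ (k ℓ : ℕ) → 1 ≤ k → k ≤ ℓ →
    NonnegCoeffs (qCatalan (k ∸ 1) ⊗ qCatalan (suc ℓ) ⊖ qpow* (suc (ℓ ∸ k)) (qCatalan k ⊗ qCatalan ℓ))
mainTheorem1 (suc k) ℓ _ k<ℓ = ≼⇒nonneg-⊖
  (subst (λ m → qpow* c (qCatalan (suc k) ⊗ qCatalan m) ≼ qCatalan k ⊗ qCatalan (suc m))
         k+c≡ℓ (qCatalan-exchange k c))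
  where
  c = suc (ℓ ∸ suc k)
  k+c≡ℓ : k + c ≡ ℓ
  k+c≡ℓ = trans (ℕₚ.+-suc k (ℓ ∸ suc k)) (ℕₚ.m+[n∸m]≡n k<ℓ)
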